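{- For every positive integer $t$, let $K_t(2)$ be the cocktail party graph on $2t$ vertices. Then $$t\,\delta(t)\le \mathrm{scc}(K_t(2))\le t\,\sigma(t),$$ where $\sigma(t)=\min\{k : t\le \binom{k-1}{\lceil k/2\rceil}\}$ and $\delta(t)=\min\{k-1 : t\le \binom{k}{\lceil k/2\rceil}\}$.
   Context: The cocktail party graph $K_t(2)$ is obtained from the complete graph on vertex set $\{x_1,\dots,x_t\}\cup\{y_1,\dots,y_t\}$ by deleting the $t$ edges $x_iy_i$, $1\le i\le t$. A clique of a graph $G$ is a set of pairwise adjacent vertices; a clique covering of $G$ is a family of cliques such that every edge of $G$ lies in at least one of them. $\mathrm{scc}(G)$ is the minimum of $\sum_{C\in\mathcal{C}}|C|$ over all clique coverings $\mathcal{C}$ of $G$. -}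

module Defs where

open import Data.Nat using (ℕ; zero; suc; _+_; _*_; _∸_; _≤_; _<_)
open import Data.Nat.Combinatorics using (_C_)
open import Data.Nat.Divisibility using ()
open import Data.Fin using (Fin)
open import Data.Bool using (Bool)
open import Data.Product using (_×_; proj₁; Σ; ∃; ∃-syntax; _,_)
open import Data.List using (List; length; map)
open import Data.Nat.ListAction using (sum)
open import Data.List.Membership.Propositional using (_∈_)
open import Data.List.Relation.Unary.Any using (Any)
open import Data.List.Relation.Unary.Unique.Propositional using (Unique)
open import Relation.Binary.PropositionalEquality using (_≡_)
open import Relation.Nullary using (¬_)

⌈_/2⌉ : ℕ → ℕ
⌈ zero /2⌉ = zero
⌈ suc zero /2⌉ = suc zero
⌈ suc (suc k) /2⌉ = suc ⌈ k /2⌉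

IsLeast : (ℕ → Set) → ℕ → Set
IsLeast P m = P m × (∀ k → P k → m ≤ k)

IsSigma : ℕ → ℕ → Set
IsSigma t = IsLeast (λ k → 1 ≤ k × t ≤ (k ∸ 1) C ⌈ k /2⌉)

-- δ(t) = min { k - 1 : k ≥ 1, t ≤ C(k, ⌈k/2⌉) } = (min { k ≥ 1 : t ≤ C(k,⌈k/2⌉) }) - 1
IsDelta : ℕ → ℕ → Set
IsDelta t d = Σ ℕ λ m → IsLeast (λ k → 1 ≤ k × t ≤ k C ⌈ k /2⌉) m × d ≡ m ∸ 1

-- Cocktail party graph K_t(2): vertex (i , false) = x_i, (i , true) = y_i.
Vertex : ℕ → Set
Vertex t = Fin t × Bool

-- distinct vertices are adjacent unless they are x_i, y_i for the same i;
-- equivalently u ~ v iff their indices differ.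
Adj : ∀ {t} → Vertex t → Vertex t → Set
Adj u v = ¬ (proj₁ u ≡ proj₁ v)

record Clique (t : ℕ) : Set where
  constructor clique
  field
    verts    : List (Vertex t)
    unique   : Unique verts
    pairwise : ∀ {u v} → u ∈ verts → v ∈ verts → ¬ (u ≡ v) → Adj u v

open Clique public

size : ∀ {t} → Clique t → ℕ
size C = length (verts C)

IsCovering : ∀ {t} → List (Clique t) → Set
IsCovering {t} 𝒞 = ∀ (u v : Vertex t) → Adj u v →
  Any (λ C → u ∈ verts C × v ∈ verts C) 𝒞

weight : ∀ {t} → List (Clique t) → ℕ
weight 𝒞 = sum (map size 𝒞)

IsSCC : ℕ → ℕ → Set
IsSCC t n = (Σ (List (Clique t)) λ 𝒞 → IsCovering 𝒞 × weight 𝒞 ≡ n)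
          × (∀ (𝒞 : List (Clique t)) → IsCovering 𝒞 → n ≤ weight 𝒞)

-- With s = σ(t), choose t distinct ⌈s/2⌉-subsets A₁, …, A_t of an
-- (s − 1)-set.  The clique {y₁, …, y_t} together with, for every point l, the clique
-- {x_i : l ∈ A_i} ∪ {y_i : l ∉ A_i} covers every edge: two distinct sets of equal size
-- are incomparable, and any two of the A_i meet since 2⌈s/2⌉ > s − 1.  These are s
-- cliques of t vertices each.
--
-- In a clique covering 𝒞 with K cliques let A_i and B_i be the sets of
-- cliques containing x_i and y_i.  They are disjoint, and A_i ∩ B_j ≠ ∅ for i ≠ j
-- because the edge x_i y_j is covered, so Bollobás' inequality
-- Σ 1 / C(a_i + b_i, a_i) ≤ 1 holds.  It is proved here in the integral form
-- Σ a_i! b_i! K! / (a_i + b_i)! ≤ K!, counting orderings of 𝒞 in which A_i precedes B_i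
-- and removing the last element of the ordering.  With M = δ(t) we have
-- C(M, ⌈M/2⌉) < t, and the tangent bound 1/C(N, a) ≥ (2 + M − N) / (2 C(M, ⌈M/2⌉))
-- turns the inequality into Σ (a_i + b_i) ≥ tM.  A clique contains at most one of x_i,
-- y_i, so Σ (a_i + b_i) is at most the weight of 𝒞.
--
-- Finally the minimum defining scc exists: whether some covering has weight at most w
-- is decidable, because such a covering can be replaced by at most w nonempty sublists
-- of a fixed enumeration of the vertices.
module Submission where

open import Defs
open import Data.Bool.Base using (Bool; true; false; not; _∨_; if_then_else_)
import Data.Bool.Properties as Bool
open import Data.Bool.Properties using (T-not-≡; T?)
open import Data.Fin.Base using (Fin; zero; suc; inject≤)
import Data.Fin.Properties as Fin
open import Data.Fin.Properties using (inject≤-injective)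
open import Data.Fin.Subset using (Subset; inside; outside; ∣_∣)
open import Data.List.Base
  using (List; []; _∷_; _++_; map; length; filter; filterᵇ; allFin; cartesianProduct; cartesianProductWith)
open import Data.List.Properties using (map-cong; map-cong-local; map-∘; length-map; length-tabulate)
open import Data.List.Membership.Propositional using (_∈_)
open import Data.List.Membership.Propositional.Properties
  using ( ∈-∃++; ∈-++⁺ˡ; ∈-++⁺ʳ; ∈-map⁺; ∈-map⁻; ∈-allFin; ∈-cartesianProduct⁺; ∈-cartesianProductWith⁺
        ; ∈-filter⁺; ∈-filter⁻)
import Data.List.Membership.DecPropositional as DecMembership
open import Data.List.Relation.Binary.Permutation.Propositional using (_↭_; ↭-refl; ↭-sym; ↭-trans; ↭-prep; ↭-swap)
open import Data.List.Relation.Binary.Permutation.Propositional.Properties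
  using (map⁺; shift; ↭-length; ∈-resp-↭; Any-resp-↭)
open import Data.List.Relation.Binary.Subset.Propositional using (_⊆_)
open import Data.List.Relation.Unary.All using (All; []; _∷_; all?)
import Data.List.Relation.Unary.All as All
import Data.List.Relation.Unary.All.Properties as All
open import Data.List.Relation.Unary.All.Properties using (all-filter)
open import Data.List.Relation.Unary.AllPairs using (AllPairs; []; _∷_; allPairs?)
import Data.List.Relation.Unary.AllPairs as AllPairs
import Data.List.Relation.Unary.AllPairs.Properties as AllPairs
open import Data.List.Relation.Unary.Any using (Any; here; there; any?)
import Data.List.Relation.Unary.Any as Any
import Data.List.Relation.Unary.Any.Properties as Any
open import Data.List.Relation.Unary.Unique.Propositional using (Unique)
import Data.List.Relation.Unary.Unique.Propositional.Properties as Unique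
open import Data.List.Relation.Unary.Unique.Propositional.Properties using (allFin⁺; cartesianProduct⁺; filter⁺)
open import Data.Nat.Base using (ℕ; zero; suc; pred; _+_; _*_; _∸_; _≤_; _<_; z≤n; s≤s; _!; >-nonZero)
open import Data.Nat.Combinatorics
  using (nCk+nC[k+1]≡[n+1]C[k+1]; nCk≡n!/k![n-k]!; k![n∸k]!∣n!) renaming (_C_ to _choose_)
open import Data.Nat.DivMod using (_/_; m*[n/m]≡n)
open import Data.Nat.ListAction using (sum)
open import Data.Nat.ListAction.Properties using (sum-↭)
open import Data.Nat.Properties hiding (⌈n/2⌉≤n)
open import Data.Nat.Tactic.RingSolver using (solve-∀)
open import Data.Product.Base using (Σ; ∃; _×_; _,_; proj₁; proj₂; map₂)
open import Data.Product.Properties using (≡-dec)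
open import Data.Sum.Base using (inj₁; inj₂)
open import Data.Vec.Base using (Vec; []; _∷_)
import Data.Vec.Base as Vec
import Data.Vec.Properties as Vec
import Data.Vec.Relation.Unary.All as VecAll
open import Data.Vec.Relation.Unary.All using ([]; _∷_)
import Data.Vec.Relation.Unary.All.Properties as VecAll
import Data.Vec.Relation.Unary.AllPairs as VecAllPairs
open import Data.Vec.Relation.Unary.AllPairs using ([]; _∷_)
import Data.Vec.Relation.Unary.AllPairs.Properties as VecAllPairs
import Data.Vec.Relation.Unary.Unique.Propositional as VecUnique
import Data.Vec.Relation.Unary.Unique.Propositional.Properties as VecUnique
open import Function.Base using (_∘_; id)
open import Function.Bundles using (Equivalence; mk⇔)
open import Relation.Binary.Definitions using (DecidableEquality; Symmetric; tri<; tri≈; tri>)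
open import Relation.Binary.PropositionalEquality
open import Relation.Nullary using (¬_; Dec; yes; no; does; contradiction; ¬?)
import Relation.Nullary.Decidable as Dec
open import Relation.Nullary.Decidable using (dec-true; _×-dec_; _→-dec_)
open import Relation.Unary using (Decidable)

private variable
  X Y : Set

binomial : ℕ → ℕ → ℕ
binomial n       zero    = 1
binomial zero    (suc k) = 0
binomial (suc n) (suc k) = binomial n k + binomial n (suc k)

binomial≡choose : ∀ n k → binomial n k ≡ n choose k
binomial≡choose n       zero    = refl
binomial≡choose zero    (suc k) = refl
binomial≡choose (suc n) (suc k) =
  trans (cong₂ _+_ (binomial≡choose n k) (binomial≡choose n (suc k))) (nCk+nC[k+1]≡[n+1]C[k+1] n k)

binomial-pos : ∀ {n k} → k ≤ n → 1 ≤ binomial n k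
binomial-pos {k = zero}           _         = ≤-refl
binomial-pos {suc n} {suc k} (s≤s k≤n) = ≤-trans (binomial-pos k≤n) (m≤m+n _ _)

binomial[n,1]≡n : ∀ n → binomial n 1 ≡ n
binomial[n,1]≡n zero    = refl
binomial[n,1]≡n (suc n) = cong suc (binomial[n,1]≡n n)

binomial-absorb : ∀ n k → suc k * binomial (suc n) (suc k) ≡ suc n * binomial n k
binomial-absorb zero    zero    = refl
binomial-absorb zero    (suc k) = *-zeroʳ (suc (suc k))
binomial-absorb (suc n) zero    =
  cong suc (trans (+-identityʳ _) (trans (binomial[n,1]≡n (suc n)) (sym (*-identityʳ (suc n)))))
binomial-absorb (suc n) (suc k) = begin
  suc (suc k) * (B (suc k) + B (suc (suc k)))               ≡⟨ *-distribˡ-+ (suc (suc k)) (B (suc k)) _ ⟩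
  suc (suc k) * B (suc k) + suc (suc k) * B (suc (suc k))   ≡⟨ cong (suc (suc k) * B (suc k) +_) (binomial-absorb n (suc k)) ⟩
  B (suc k) + suc k * B (suc k) + suc n * b (suc k)
    ≡⟨ cong (λ z → B (suc k) + z + suc n * b (suc k)) (binomial-absorb n k) ⟩
  B (suc k) + suc n * b k + suc n * b (suc k)               ≡⟨ +-assoc (B (suc k)) _ _ ⟩
  B (suc k) + (suc n * b k + suc n * b (suc k))             ≡⟨ cong (B (suc k) +_) (*-distribˡ-+ (suc n) (b k) _) ⟨
  suc (suc n) * B (suc k)                                   ∎
  where
  open ≡-Reasoning
  b = binomial n
  B = binomial (suc n)

binomial-suc-ratio : ∀ n k → suc k * binomial n (suc k) + suc k * binomial n k ≡ suc n * binomial n k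
binomial-suc-ratio n k = begin
  suc k * binomial n (suc k) + suc k * binomial n k ≡⟨ +-comm (suc k * binomial n (suc k)) _ ⟩
  suc k * binomial n k + suc k * binomial n (suc k) ≡⟨ *-distribˡ-+ (suc k) (binomial n k) (binomial n (suc k)) ⟨
  suc k * binomial (suc n) (suc k)                  ≡⟨ binomial-absorb n k ⟩
  suc n * binomial n k                              ∎
  where open ≡-Reasoning

binomial-increasing : ∀ {n k} → 2 * suc k ≤ suc n → binomial n k ≤ binomial n (suc k)
binomial-increasing {n} {k} 2[k+1]≤n+1 =
  *-cancelˡ-≤ (suc k) (+-cancelʳ-≤ (suc k * binomial n k) _ _ (begin
    suc k * binomial n k + suc k * binomial n k   ≡⟨ cong (suc k * binomial n k +_) (+-identityʳ _) ⟨
    2 * (suc k * binomial n k)                    ≡⟨ *-assoc 2 (suc k) _ ⟨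
    2 * suc k * binomial n k                      ≤⟨ *-monoˡ-≤ (binomial n k) 2[k+1]≤n+1 ⟩
    suc n * binomial n k                          ≡⟨ binomial-suc-ratio n k ⟨
    suc k * binomial n (suc k) + suc k * binomial n k ∎))
  where open ≤-Reasoning

binomial-decreasing : ∀ {n k} → suc n ≤ 2 * suc k → binomial n (suc k) ≤ binomial n k
binomial-decreasing {n} {k} n+1≤2[k+1] =
  *-cancelˡ-≤ (suc k) (+-cancelʳ-≤ (suc k * binomial n k) _ _ (begin
    suc k * binomial n (suc k) + suc k * binomial n k ≡⟨ binomial-suc-ratio n k ⟩
    suc n * binomial n k                          ≤⟨ *-monoˡ-≤ (binomial n k) n+1≤2[k+1] ⟩
    2 * suc k * binomial n k                      ≡⟨ *-assoc 2 (suc k) _ ⟩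
    2 * (suc k * binomial n k)                    ≡⟨ cong (suc k * binomial n k +_) (+-identityʳ _) ⟩
    suc k * binomial n k + suc k * binomial n k   ∎))
  where open ≤-Reasoning

binomial-increasing-upto : ∀ {n} k d → 2 * (k + d) ≤ suc n → binomial n k ≤ binomial n (k + d)
binomial-increasing-upto {n} k zero    _ = ≤-reflexive (cong (binomial n) (sym (+-identityʳ k)))
binomial-increasing-upto {n} k (suc d) h = begin
  binomial n k             ≤⟨ binomial-increasing-upto k d (≤-trans (*-monoʳ-≤ 2 (+-monoʳ-≤ k (n≤1+n d))) h) ⟩
  binomial n (k + d)       ≤⟨ binomial-increasing (≤-trans (≤-reflexive (cong (2 *_) (sym (+-suc k d)))) h) ⟩
  binomial n (suc (k + d)) ≡⟨ cong (binomial n) (+-suc k d) ⟨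
  binomial n (k + suc d)   ∎
  where open ≤-Reasoning

binomial-decreasing-from : ∀ {n} k d → n ≤ 2 * k → binomial n (k + d) ≤ binomial n k
binomial-decreasing-from {n} k zero    _ = ≤-reflexive (cong (binomial n) (+-identityʳ k))
binomial-decreasing-from {n} k (suc d) h = begin
  binomial n (k + suc d)   ≡⟨ cong (binomial n) (+-suc k d) ⟩
  binomial n (suc (k + d)) ≤⟨ binomial-decreasing n+1≤2[k+d+1] ⟩
  binomial n (k + d)       ≤⟨ binomial-decreasing-from k d h ⟩
  binomial n k             ∎
  where
  open ≤-Reasoning
  n+1≤2[k+d+1] : suc n ≤ 2 * suc (k + d)
  n+1≤2[k+d+1] = begin
    suc n                ≤⟨ s≤s h ⟩
    suc (2 * k)          ≤⟨ n≤1+n _ ⟩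
    2 + 2 * k            ≡⟨ *-suc 2 k ⟨
    2 * suc k            ≤⟨ *-monoʳ-≤ 2 (s≤s (m≤m+n k d)) ⟩
    2 * suc (k + d)      ∎

data EvenOdd : ℕ → Set where
  even : ∀ m → EvenOdd (m + m)
  odd  : ∀ m → EvenOdd (suc (m + m))

even-or-odd : ∀ n → EvenOdd n
even-or-odd zero = even 0
even-or-odd (suc n) with even-or-odd n
... | even m = odd m
... | odd m  = subst EvenOdd (cong suc (+-suc m m)) (even (suc m))

⌈m+m/2⌉≡m : ∀ m → ⌈ m + m /2⌉ ≡ m
⌈m+m/2⌉≡m zero    = refl
⌈m+m/2⌉≡m (suc m) rewrite +-suc m m = cong suc (⌈m+m/2⌉≡m m)

⌈1+m+m/2⌉≡1+m : ∀ m → ⌈ suc (m + m) /2⌉ ≡ suc m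
⌈1+m+m/2⌉≡1+m zero    = refl
⌈1+m+m/2⌉≡1+m (suc m) rewrite +-suc m m = cong suc (⌈1+m+m/2⌉≡1+m m)

2*⌈n/2⌉≤1+n : ∀ n → 2 * ⌈ n /2⌉ ≤ suc n
2*⌈n/2⌉≤1+n zero          = z≤n
2*⌈n/2⌉≤1+n (suc zero)    = ≤-refl
2*⌈n/2⌉≤1+n (suc (suc n)) = begin
  2 * suc ⌈ n /2⌉  ≡⟨ *-suc 2 ⌈ n /2⌉ ⟩
  2 + 2 * ⌈ n /2⌉  ≤⟨ +-monoʳ-≤ 2 (2*⌈n/2⌉≤1+n n) ⟩
  suc (suc (suc n)) ∎
  where open ≤-Reasoning

n≤2*⌈n/2⌉ : ∀ n → n ≤ 2 * ⌈ n /2⌉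
n≤2*⌈n/2⌉ zero          = z≤n
n≤2*⌈n/2⌉ (suc zero)    = s≤s z≤n
n≤2*⌈n/2⌉ (suc (suc n)) = begin
  suc (suc n)     ≤⟨ +-monoʳ-≤ 2 (n≤2*⌈n/2⌉ n) ⟩
  2 + 2 * ⌈ n /2⌉ ≡⟨ *-suc 2 ⌈ n /2⌉ ⟨
  2 * suc ⌈ n /2⌉ ∎
  where open ≤-Reasoning

central : ℕ → ℕ
central n = binomial n ⌈ n /2⌉

binomial≤central : ∀ n k → binomial n k ≤ central n
binomial≤central n k with ≤-total k ⌈ n /2⌉
... | inj₁ k≤c = subst (λ c → binomial n k ≤ binomial n c) (m+[n∸m]≡n k≤c)
                   (binomial-increasing-upto k _ (subst (λ c → 2 * c ≤ suc n) (sym (m+[n∸m]≡n k≤c)) (2*⌈n/2⌉≤1+n n)))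
... | inj₂ c≤k = subst (λ j → binomial n j ≤ central n) (m+[n∸m]≡n c≤k)
                   (binomial-decreasing-from ⌈ n /2⌉ _ (n≤2*⌈n/2⌉ n))

central-pos : ∀ n → 1 ≤ central n
central-pos n = binomial-pos (⌈n/2⌉≤n n)
  where
  ⌈n/2⌉≤n : ∀ n → ⌈ n /2⌉ ≤ n
  ⌈n/2⌉≤n zero          = z≤n
  ⌈n/2⌉≤n (suc zero)    = ≤-refl
  ⌈n/2⌉≤n (suc (suc n)) = s≤s (m≤n⇒m≤1+n (⌈n/2⌉≤n n))

central-suc≤ : ∀ n → central (suc n) ≤ 2 * central n
central-suc≤ zero    = s≤s z≤n
central-suc≤ (suc n) = begin
  binomial (suc n) ⌈ n /2⌉ + binomial (suc n) (suc ⌈ n /2⌉)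
    ≤⟨ +-mono-≤ (binomial≤central (suc n) ⌈ n /2⌉) (binomial≤central (suc n) (suc ⌈ n /2⌉)) ⟩
  central (suc n) + central (suc n)
    ≡⟨ cong (central (suc n) +_) (+-identityʳ _) ⟨
  2 * central (suc n) ∎
  where open ≤-Reasoning

central-growth-even : ∀ k → 1 ≤ k → 3 * central (k + k) ≤ 2 * central (suc (k + k))
central-growth-even k 1≤k = *-cancelˡ-≤ (suc k) (begin
  suc k * (3 * central (k + k))   ≡⟨ cong (λ c → suc k * (3 * binomial (k + k) c)) (⌈m+m/2⌉≡m k) ⟩
  suc k * (3 * b)                 ≡⟨ x∙yz≈y∙xz (suc k) 3 b ⟩
  3 * (suc k * b)                 ≡⟨ *-assoc 3 (suc k) b ⟨
  3 * suc k * b                   ≤⟨ *-monoˡ-≤ b 3[k+1]≤2[2k+1] ⟩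
  2 * suc (k + k) * b             ≡⟨ *-assoc 2 (suc (k + k)) b ⟩
  2 * (suc (k + k) * b)           ≡⟨ cong (2 *_) (binomial-absorb (k + k) k) ⟨
  2 * (suc k * b′)                ≡⟨ x∙yz≈y∙xz 2 (suc k) b′ ⟩
  suc k * (2 * b′)                ≡⟨ cong (λ c → suc k * (2 * binomial (suc (k + k)) c)) (⌈1+m+m/2⌉≡1+m k) ⟨
  suc k * (2 * central (suc (k + k))) ∎)
  where
  open ≤-Reasoning
  open import Algebra.Properties.CommutativeSemigroup *-commutativeSemigroup using (x∙yz≈y∙xz)
  b  = binomial (k + k) k
  b′ = binomial (suc (k + k)) (suc k)
  3[k+1]≤2[2k+1] : 3 * suc k ≤ 2 * suc (k + k)
  3[k+1]≤2[2k+1] = begin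
    3 * suc k         ≡⟨ expand₁ k ⟩
    1 + (2 + 3 * k)   ≤⟨ +-monoˡ-≤ (2 + 3 * k) 1≤k ⟩
    k + (2 + 3 * k)   ≡⟨ expand₂ k ⟨
    2 * suc (k + k)   ∎
    where
    expand₁ : ∀ k → 3 * suc k ≡ 1 + (2 + 3 * k)
    expand₁ = solve-∀
    expand₂ : ∀ k → 2 * suc (k + k) ≡ k + (2 + 3 * k)
    expand₂ = solve-∀

central-odd-suc : ∀ m → central (suc (suc (m + m))) ≡ 2 * central (suc (m + m))
central-odd-suc m = begin
  central (suc (suc (m + m)))
    ≡⟨ cong (λ c → binomial (suc (m + m)) c + binomial (suc (m + m)) (suc c)) (⌈m+m/2⌉≡m m) ⟩
  binomial (suc (m + m)) m + b                           ≡⟨ cong (_+ b) middle-symmetric ⟨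
  b + b                                                  ≡⟨ cong (b +_) (+-identityʳ b) ⟨
  2 * b                                                  ≡⟨ cong (λ c → 2 * binomial (suc (m + m)) c) (⌈1+m+m/2⌉≡1+m m) ⟨
  2 * central (suc (m + m))                              ∎
  where
  open ≡-Reasoning
  b = binomial (suc (m + m)) (suc m)
  middle-symmetric : b ≡ binomial (suc (m + m)) m
  middle-symmetric = *-cancelˡ-≡ b _ (suc m) (+-cancelʳ-≡ (suc m * binomial (suc (m + m)) m) _ _ (begin
    suc m * b + suc m * binomial (suc (m + m)) m    ≡⟨ binomial-suc-ratio (suc (m + m)) m ⟩
    suc (suc (m + m)) * binomial (suc (m + m)) m    ≡⟨ cong (_* binomial (suc (m + m)) m) (cong suc (+-suc m m)) ⟨
    (suc m + suc m) * binomial (suc (m + m)) m      ≡⟨ *-distribʳ-+ (binomial (suc (m + m)) m) (suc m) (suc m) ⟩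
    suc m * binomial (suc (m + m)) m + suc m * binomial (suc (m + m)) m ∎))

central-growth : ∀ n → 1 ≤ n → 3 * central n ≤ 2 * central (suc n)
central-growth n 1≤n with even-or-odd n
central-growth _ () | even zero
... | even (suc m) = central-growth-even (suc m) (s≤s z≤n)
... | odd m  = begin
  3 * central (suc (m + m))     ≤⟨ *-monoˡ-≤ (central (suc (m + m))) (n≤1+n 3) ⟩
  4 * central (suc (m + m))     ≡⟨ *-assoc 2 2 (central (suc (m + m))) ⟩
  2 * (2 * central (suc (m + m))) ≡⟨ cong (2 *_) (central-odd-suc m) ⟨
  2 * central (suc (suc (m + m))) ∎
  where open ≤-Reasoning

central-mono-suc : ∀ n → central n ≤ central (suc n)
central-mono-suc zero    = ≤-refl
central-mono-suc (suc n) =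
  *-cancelˡ-≤ 2 (≤-trans (*-monoˡ-≤ (central (suc n)) (n≤1+n 2)) (central-growth (suc n) (s≤s z≤n)))

central-mono : ∀ n d → central n ≤ central (n + d)
central-mono n zero    = ≤-reflexive (cong central (sym (+-identityʳ n)))
central-mono n (suc d) = ≤-trans (central-mono n d)
  (≤-trans (central-mono-suc (n + d)) (≤-reflexive (cong central (sym (+-suc n d)))))

central-tangent : ∀ N d → 1 ≤ N → central N * (2 + d) ≤ 2 * central (N + d)
central-tangent N zero    _   = ≤-reflexive (trans (*-comm (central N) 2) (cong (λ n → 2 * central n) (sym (+-identityʳ N))))
central-tangent N (suc d) 1≤N = begin
  central N * (3 + d)                  ≡⟨ *-suc-assoc (central N) d ⟩
  central N * (2 + d) + central N      ≤⟨ +-mono-≤ (central-tangent N d 1≤N) (central-mono N d) ⟩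
  2 * central (N + d) + central (N + d) ≡⟨ +-comm (2 * central (N + d)) _ ⟩
  3 * central (N + d)                  ≤⟨ central-growth (N + d) (≤-trans 1≤N (m≤m+n N d)) ⟩
  2 * central (suc (N + d))            ≡⟨ cong (λ n → 2 * central n) (+-suc N d) ⟨
  2 * central (N + suc d)              ∎
  where
  open ≤-Reasoning
  *-suc-assoc : ∀ c d → c * (3 + d) ≡ c * (2 + d) + c
  *-suc-assoc = solve-∀

-- 1 / C(N, a) ≥ (2 + M − N) / (2 · central M), cleared of denominators and of truncated
-- subtraction.
binomial-tangent : ∀ {N} a M → 1 ≤ N → binomial N a * (2 + M) ≤ 2 * central M + binomial N a * N
binomial-tangent {N} a M 1≤N with <-cmp N (suc M)
... | tri> _ _ 1+M<N = ≤-trans (*-monoʳ-≤ (binomial N a) 1+M<N) (m≤n+m _ _)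
... | tri≈ _ refl _ = begin
  binomial N a * (2 + M)           ≡⟨ *-suc (binomial N a) N ⟩
  binomial N a + binomial N a * N  ≤⟨ +-monoˡ-≤ _ (≤-trans (binomial≤central N a) (central-suc≤ M)) ⟩
  2 * central M + binomial N a * N ∎
  where open ≤-Reasoning
... | tri< N<1+M _ _ = begin
  binomial N a * (2 + M)                  ≡⟨ cong (λ m → binomial N a * (2 + m)) N+d≡M ⟨
  binomial N a * (2 + (N + d))            ≡⟨ split (binomial N a) N d ⟩
  binomial N a * (2 + d) + binomial N a * N
    ≤⟨ +-monoˡ-≤ _ (≤-trans (*-monoˡ-≤ (2 + d) (binomial≤central N a)) (central-tangent N d 1≤N)) ⟩
  2 * central (N + d) + binomial N a * N  ≡⟨ cong (λ m → 2 * central m + binomial N a * N) N+d≡M ⟩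
  2 * central M + binomial N a * N        ∎
  where
  open ≤-Reasoning
  d = M ∸ N
  N+d≡M : N + d ≡ M
  N+d≡M = m+[n∸m]≡n (≤-pred N<1+M)
  split : ∀ b n d → b * (2 + (n + d)) ≡ b * (2 + d) + b * n
  split = solve-∀

factorial-binomial : ∀ a b → a ! * b ! * binomial (a + b) a ≡ (a + b) !
factorial-binomial a b = begin
  a ! * b ! * binomial (a + b) a
    ≡⟨ cong₂ (λ c d → a ! * c ! * d) (m+n∸m≡n a b) (sym (binomial≡choose (a + b) a)) ⟨
  a ! * (a + b ∸ a) ! * ((a + b) choose a)
    ≡⟨ cong (a ! * (a + b ∸ a) ! *_) (nCk≡n!/k![n-k]! (m≤m+n a b)) ⟩
  a ! * (a + b ∸ a) ! * ((a + b) ! / (a ! * (a + b ∸ a) !))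
    ≡⟨ m*[n/m]≡n (k![n∸k]!∣n! (m≤m+n a b)) ⟩
  (a + b) ! ∎
  where
  open ≡-Reasoning
  instance _ = m*n≢0 (a !) ((a + b ∸ a) !) {{a !≢0}} {{(a + b ∸ a) !≢0}}

rising : ℕ → ℕ → ℕ
rising k zero    = 1
rising k (suc d) = suc (k + d) * rising k d

rising-! : ∀ k d → rising k d * k ! ≡ (k + d) !
rising-! k zero    = trans (+-identityʳ (k !)) (cong _! (sym (+-identityʳ k)))
rising-! k (suc d) = begin
  suc (k + d) * rising k d * k ! ≡⟨ *-assoc (suc (k + d)) (rising k d) (k !) ⟩
  suc (k + d) * (rising k d * k !) ≡⟨ cong (suc (k + d) *_) (rising-! k d) ⟩
  suc (k + d) !                  ≡⟨ cong _! (+-suc k d) ⟨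
  (k + suc d) !                  ∎
  where open ≡-Reasoning

rising-shift : ∀ k d → rising k (suc d) ≡ suc k * rising (suc k) d
rising-shift k zero    = cong (λ n → suc n * 1) (+-identityʳ k)
rising-shift k (suc d) = begin
  suc (k + suc d) * rising k (suc d)       ≡⟨ cong (suc (k + suc d) *_) (rising-shift k d) ⟩
  suc (k + suc d) * (suc k * rising (suc k) d) ≡⟨ x∙yz≈y∙xz (suc (k + suc d)) (suc k) _ ⟩
  suc k * (suc (k + suc d) * rising (suc k) d) ≡⟨ cong (λ n → suc k * (suc n * rising (suc k) d)) (+-suc k d) ⟩
  suc k * rising (suc k) (suc d)           ∎
  where
  open ≡-Reasoning
  open import Algebra.Properties.CommutativeSemigroup *-commutativeSemigroup using (x∙yz≈y∙xz)

-- a! b! (a + b + r)! / (a + b)! counts the orderings of a + b + r objects in which a fixed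
-- a-set precedes a fixed disjoint b-set.
lubell : ℕ → ℕ → ℕ → ℕ
lubell a b r = a ! * b ! * rising (a + b) r

lubell-binomial : ∀ a b r → lubell a b r * binomial (a + b) a ≡ (a + b + r) !
lubell-binomial a b r = begin
  a ! * b ! * rising (a + b) r * binomial (a + b) a   ≡⟨ rearrange (a !) (b !) (rising (a + b) r) _ ⟩
  rising (a + b) r * (a ! * b ! * binomial (a + b) a) ≡⟨ cong (rising (a + b) r *_) (factorial-binomial a b) ⟩
  rising (a + b) r * (a + b) !                        ≡⟨ rising-! (a + b) r ⟩
  (a + b + r) !                                       ∎
  where
  open ≡-Reasoning
  rearrange : ∀ x y z w → x * y * z * w ≡ z * (x * y * w)
  rearrange = solve-∀

lubell≤! : ∀ a b r → lubell a b r ≤ (a + b + r) !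
lubell≤! a b r = begin
  lubell a b r                       ≤⟨ m≤m*n (lubell a b r) (binomial (a + b) a) ⟩
  lubell a b r * binomial (a + b) a  ≡⟨ lubell-binomial a b r ⟩
  (a + b + r) !                      ∎
  where
  open ≤-Reasoning
  instance _ = >-nonZero (binomial-pos (m≤m+n a b))

lubell-suc : ∀ a b r → lubell a (suc b) r ≡ suc b * lubell a b r + r * lubell a (suc b) (pred r)
lubell-suc a b zero    = rearrange (a !) b (b !)
  where
  rearrange : ∀ x b y → x * (suc b * y) * 1 ≡ suc b * (x * y * 1) + 0
  rearrange = solve-∀
lubell-suc a b (suc e) = begin
  a ! * suc b ! * (suc (a + suc b + e) * rising (a + suc b) e)
    ≡⟨ cong (λ R → a ! * suc b ! * (suc (a + suc b + e) * R)) rising-a+1+b ⟩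
  a ! * suc b ! * (suc (a + suc b + e) * R)
    ≡⟨ rearrange (a !) (b !) a b e R ⟩
  suc b * (a ! * b ! * (suc (a + b) * R)) + suc e * (a ! * suc b ! * R)
    ≡⟨ cong₂ (λ R₁ R₂ → suc b * (a ! * b ! * R₁) + suc e * (a ! * suc b ! * R₂)) (rising-shift (a + b) e) rising-a+1+b ⟨
  suc b * lubell a b (suc e) + suc e * lubell a (suc b) e ∎
  where
  open ≡-Reasoning
  R = rising (suc (a + b)) e
  rising-a+1+b : rising (a + suc b) e ≡ R
  rising-a+1+b = cong (λ k → rising k e) (+-suc a b)
  rearrange : ∀ x y a b e R → x * (suc b * y) * (suc (a + suc b + e) * R)
                            ≡ suc b * (x * y * (suc (a + b) * R)) + suc e * (x * (suc b * y) * R)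
  rearrange = solve-∀

lubell-tangent : ∀ a b r M → 1 ≤ a + b →
  (a + b + r) ! * (2 + M) ≤ 2 * central M * lubell a b r + (a + b + r) ! * (a + b)
lubell-tangent a b r M 1≤a+b = begin
  (a + b + r) ! * (2 + M)                        ≡⟨ cong (_* (2 + M)) (lubell-binomial a b r) ⟨
  ℓ * c * (2 + M)                                ≡⟨ *-assoc ℓ c (2 + M) ⟩
  ℓ * (c * (2 + M))                              ≤⟨ *-monoʳ-≤ ℓ (binomial-tangent a M 1≤a+b) ⟩
  ℓ * (2 * central M + c * (a + b))              ≡⟨ rearrange ℓ (central M) c (a + b) ⟩
  2 * central M * ℓ + ℓ * c * (a + b)            ≡⟨ cong (λ n → 2 * central M * ℓ + n * (a + b)) (lubell-binomial a b r) ⟩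
  2 * central M * ℓ + (a + b + r) ! * (a + b)    ∎
  where
  open ≤-Reasoning
  ℓ = lubell a b r
  c = binomial (a + b) a
  rearrange : ∀ ℓ m c n → ℓ * (2 * m + c * n) ≡ 2 * m * ℓ + ℓ * c * n
  rearrange = solve-∀

iverson : Bool → ℕ
iverson true  = 1
iverson false = 0

count : (X → Bool) → List X → ℕ
count p xs = sum (map (iverson ∘ p) xs)

sum-map-mono : ∀ {f g : X → ℕ} {xs} → All (λ x → f x ≤ g x) xs → sum (map f xs) ≤ sum (map g xs)
sum-map-mono []           = z≤n
sum-map-mono (fx≤gx ∷ ps) = +-mono-≤ fx≤gx (sum-map-mono ps)

sum-map-+ : ∀ (f g : X → ℕ) xs → sum (map (λ x → f x + g x) xs) ≡ sum (map f xs) + sum (map g xs)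
sum-map-+ f g []       = refl
sum-map-+ f g (x ∷ xs) =
  trans (cong (f x + g x +_) (sum-map-+ f g xs)) (interchange (f x) (g x) (sum (map f xs)) (sum (map g xs)))
  where open import Algebra.Properties.CommutativeSemigroup +-commutativeSemigroup using (interchange)

sum-map-* : ∀ c (f : X → ℕ) xs → sum (map (λ x → c * f x) xs) ≡ c * sum (map f xs)
sum-map-* c f []       = sym (*-zeroʳ c)
sum-map-* c f (x ∷ xs) = trans (cong (c * f x +_) (sum-map-* c f xs)) (sym (*-distribˡ-+ c (f x) _))

sum-map-const : ∀ c (xs : List X) → sum (map (λ _ → c) xs) ≡ length xs * c
sum-map-const c []       = refl
sum-map-const c (x ∷ xs) = cong (c +_) (sum-map-const c xs)

sum-map-comm : ∀ (f : X → Y → ℕ) xs ys →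
  sum (map (λ x → sum (map (f x) ys)) xs) ≡ sum (map (λ y → sum (map (λ x → f x y) xs)) ys)
sum-map-comm f []       ys = sym (trans (sum-map-const 0 ys) (*-zeroʳ (length ys)))
sum-map-comm f (x ∷ xs) ys = begin
  sum (map (f x) ys) + sum (map (λ x → sum (map (f x) ys)) xs)
    ≡⟨ cong (sum (map (f x) ys) +_) (sum-map-comm f xs ys) ⟩
  sum (map (f x) ys) + sum (map (λ y → sum (map (λ x → f x y) xs)) ys)
    ≡⟨ sum-map-+ (f x) (λ y → sum (map (λ x → f x y) xs)) ys ⟨
  sum (map (λ y → f x y + sum (map (λ x → f x y) xs)) ys) ∎
  where open ≡-Reasoning

sum-map-filterᵇ : ∀ (p : X → Bool) (f : X → ℕ) xs →
  sum (map f (filterᵇ p xs)) ≡ sum (map (λ x → if p x then f x else 0) xs)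
sum-map-filterᵇ p f []       = refl
sum-map-filterᵇ p f (x ∷ xs) with p x
... | true  = cong (f x +_) (sum-map-filterᵇ p f xs)
... | false = sum-map-filterᵇ p f xs

count-↭ : ∀ (p : X → Bool) {xs ys} → xs ↭ ys → count p xs ≡ count p ys
count-↭ p xs↭ys = sum-↭ (map⁺ (iverson ∘ p) xs↭ys)

picks : List X → List (X × List X)
picks []       = []
picks (x ∷ xs) = (x , xs) ∷ map (map₂ (x ∷_)) (picks xs)

map-proj₁-picks : ∀ (xs : List X) → map proj₁ (picks xs) ≡ xs
map-proj₁-picks []       = refl
map-proj₁-picks (x ∷ xs) = cong (x ∷_) (trans (sym (map-∘ (picks xs))) (map-proj₁-picks xs))

picks-↭ : ∀ (xs : List X) → All (λ (y , ys) → xs ↭ y ∷ ys) (picks xs)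
picks-↭ []       = []
picks-↭ (x ∷ xs) =
  ↭-refl ∷ All.map⁺ (All.map (λ {(y , ys)} xs↭y∷ys → ↭-trans (↭-prep x xs↭y∷ys) (↭-swap x y ↭-refl))
                             (picks-↭ xs))

count≡length-filter : ∀ {P : X → Set} (P? : Decidable P) xs → count (does ∘ P?) xs ≡ length (filter P? xs)
count≡length-filter P? []       = refl
count≡length-filter P? (x ∷ xs) with does (P? x)
... | true  = cong suc (count≡length-filter P? xs)
... | false = count≡length-filter P? xs

Unique∧⊆⇒length≤ : ∀ {xs ys : List X} → Unique xs → xs ⊆ ys → length xs ≤ length ys
Unique∧⊆⇒length≤ {xs = []}     _              _     = z≤n
Unique∧⊆⇒length≤ {xs = x ∷ xs} (x∉xs ∷ !xs) xs⊆ys with ys₁ , ys₂ , refl ← ∈-∃++ (xs⊆ys (here refl)) =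
  ≤-trans (s≤s (Unique∧⊆⇒length≤ !xs xs⊆ys₁++ys₂)) (≤-reflexive (↭-length (↭-sym (shift x ys₁ ys₂))))
  where
  xs⊆ys₁++ys₂ : xs ⊆ ys₁ ++ ys₂
  xs⊆ys₁++ys₂ y∈xs with ∈-resp-↭ (shift x ys₁ ys₂) (xs⊆ys (there y∈xs))
  ... | here y≡x    = contradiction (sym y≡x) (All.lookup x∉xs y∈xs)
  ... | there y∈ys′ = y∈ys′

sum-map-filter≤ : ∀ {P : X → Set} (P? : Decidable P) (f : X → ℕ) xs → sum (map f (filter P? xs)) ≤ sum (map f xs)
sum-map-filter≤ P? f []       = z≤n
sum-map-filter≤ P? f (x ∷ xs) with does (P? x)
... | true  = +-monoʳ-≤ (f x) (sum-map-filter≤ P? f xs)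
... | false = ≤-trans (sum-map-filter≤ P? f xs) (m≤n+m _ (f x))

AllPairs-map-All : ∀ {P : X → Set} {R S : X → X → Set} {xs} →
  (∀ {x y} → P x → P y → R x y → S x y) → All P xs → AllPairs R xs → AllPairs S xs
AllPairs-map-All f []         []         = []
AllPairs-map-All f (px ∷ pxs) (rx ∷ rxs) =
  All.zipWith (λ (py , r) → f px py r) (pxs , rx) ∷ AllPairs-map-All f pxs rxs

least : ∀ {P : ℕ → Set} → Decidable P → ∀ {n} → P n → ∃ (IsLeast P)
least P? {n} Pn with P? 0
... | yes P0 = 0 , P0 , λ _ _ → z≤n
least P? {zero}  P0 | no ¬P0 = contradiction P0 ¬P0
least P? {suc n} Pn | no ¬P0 with m , Pm , m-least ← least (P? ∘ suc) Pn =
  suc m , Pm , λ { zero P0 → contradiction P0 ¬P0 ; (suc k) Pk → s≤s (m-least k Pk) }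

minimum-exists : ∀ {Q : X → Set} (w : X → ℕ) → (∀ n → Dec (∃ λ x → Q x × w x ≤ n)) →
  ∀ {x₀} → Q x₀ → ∃ λ n → (∃ λ x → Q x × w x ≡ n) × (∀ x → Q x → n ≤ w x)
minimum-exists {Q = Q} w bounded? {x₀} Qx₀ with m , (x , Qx , wx≤m) , m-least ← least bounded? (x₀ , Qx₀ , ≤-refl) =
  m , (x , Qx , ≤-antisym wx≤m (below x Qx)) , below
  where
  below : ∀ x → Q x → m ≤ w x
  below x Qx = m-least (w x) (x , Qx , ≤-refl)

sublists : List X → List (List X)
sublists []       = [] ∷ []
sublists (x ∷ xs) = map (x ∷_) (sublists xs) ++ sublists xs

filter∈sublists : ∀ {P : X → Set} (P? : Decidable P) xs → filter P? xs ∈ sublists xs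
filter∈sublists P? []       = here refl
filter∈sublists P? (x ∷ xs) with does (P? x)
... | true  = ∈-++⁺ˡ (∈-map⁺ (x ∷_) (filter∈sublists P? xs))
... | false = ∈-++⁺ʳ _ (filter∈sublists P? xs)

boundedLists : List X → ℕ → List (List X)
boundedLists cs zero    = [] ∷ []
boundedLists cs (suc w) = [] ∷ cartesianProductWith _∷_ cs (boundedLists cs w)

∈-boundedLists : ∀ {cs xs : List X} w → All (_∈ cs) xs → length xs ≤ w → xs ∈ boundedLists cs w
∈-boundedLists zero    []             _             = here refl
∈-boundedLists (suc w) []             _             = here refl
∈-boundedLists (suc w) (x∈cs ∷ xs⊆cs) (s≤s |xs|≤w) =
  there (∈-cartesianProductWith⁺ _∷_ x∈cs (∈-boundedLists w xs⊆cs |xs|≤w))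

AllPairs⇒pairwise : ∀ {R : X → X → Set} → Symmetric R → ∀ {xs} → AllPairs R xs →
  ∀ {x y} → x ∈ xs → y ∈ xs → x ≢ y → R x y
AllPairs⇒pairwise sym (Rx ∷ _)  (here refl) (here refl) x≢y = contradiction refl x≢y
AllPairs⇒pairwise sym (Rx ∷ _)  (here refl) (there y∈)  _   = All.lookup Rx y∈
AllPairs⇒pairwise sym (Rx ∷ _)  (there x∈)  (here refl) _   = sym (All.lookup Rx x∈)
AllPairs⇒pairwise sym (_ ∷ Rxs) (there x∈)  (there y∈)  x≢y = AllPairs⇒pairwise sym Rxs x∈ y∈ x≢y

Any-filter⁺ : ∀ {P Q : X → Set} (Q? : Decidable Q) {xs} → (∀ {x} → P x → Q x) → Any P xs → Any P (filter Q? xs)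
Any-filter⁺ Q? {x ∷ xs} P⇒Q (here Px) with Q? x
... | yes _  = here Px
... | no ¬Qx = contradiction (P⇒Q Px) ¬Qx
Any-filter⁺ Q? {x ∷ xs} P⇒Q (there Pxs) with does (Q? x)
... | true  = there (Any-filter⁺ Q? P⇒Q Pxs)
... | false = Any-filter⁺ Q? P⇒Q Pxs

-- Bollobás' inequality

module Bollobás {G I : Set} (A B : I → G → Bool)
                (disjoint : ∀ i g → A i g ≡ true → B i g ≡ false) where

  #A #B #R : I → List G → ℕ
  #A i = count (A i)
  #B i = count (B i)
  #R i = count (λ g → not (A i g ∨ B i g))

  #A+#B+#R≡length : ∀ i L → #A i L + #B i L + #R i L ≡ length L
  #A+#B+#R≡length i []      = refl
  #A+#B+#R≡length i (x ∷ L) with A i x in Aix | B i x in Bix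
  ... | true  | true  = contradiction (trans (sym (disjoint i x Aix)) Bix) λ ()
  ... | true  | false = cong suc (#A+#B+#R≡length i L)
  ... | false | true  = trans (cong (_+ #R i L) (+-suc (#A i L) (#B i L))) (cong suc (#A+#B+#R≡length i L))
  ... | false | false = trans (+-suc (#A i L + #B i L) (#R i L)) (cong suc (#A+#B+#R≡length i L))

  lubellAt : I → List G → ℕ
  lubellAt i L = lubell (#A i L) (#B i L) (#R i L)

  lubellAt≤! : ∀ i L → lubellAt i L ≤ length L !
  lubellAt≤! i L = subst (λ n → lubellAt i L ≤ n !) (#A+#B+#R≡length i L) (lubell≤! (#A i L) (#B i L) (#R i L))

  Meets : I → I → List G → Set
  Meets i j = Any (λ g → A i g ≡ true × B j g ≡ true)

  CrossIntersecting : List G → List I → Set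
  CrossIntersecting L = AllPairs (λ i j → Meets i j L × Meets j i L)

  Meets⇒#B-pos : ∀ {i j L} → Meets i j L → 1 ≤ #B j L
  Meets⇒#B-pos {L = x ∷ L} (here (_ , Bjx)) rewrite Bjx = s≤s z≤n
  Meets⇒#B-pos {L = x ∷ L} (there m)        = ≤-trans (Meets⇒#B-pos m) (m≤n+m _ _)

  CrossIntersecting⇒#B-pos : ∀ {L Is} → 2 ≤ length Is → CrossIntersecting L Is → All (λ k → 1 ≤ #B k L) Is
  CrossIntersecting⇒#B-pos {Is = _ ∷ _ ∷ _} _ (((Mij , Mji) ∷ Mik) ∷ _) =
    Meets⇒#B-pos Mji ∷ Meets⇒#B-pos Mij ∷ All.map (Meets⇒#B-pos ∘ proj₁) Mik
  CrossIntersecting⇒#B-pos {Is = _ ∷ []} (s≤s ()) _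

  count-pick : ∀ (p : G → Bool) {L x L′ β} → L ↭ x ∷ L′ → p x ≡ β → count p L ≡ iverson β + count p L′
  count-pick p L↭x∷L′ refl = count-↭ p L↭x∷L′

  Meets-pick : ∀ {i j L x L′} → L ↭ x ∷ L′ → A i x ≡ false → Meets i j L → Meets i j L′
  Meets-pick L↭x∷L′ Aix≡false Mij with Any-resp-↭ L↭x∷L′ Mij
  ... | here (Aix≡true , _) = contradiction (trans (sym Aix≡true) Aix≡false) λ ()
  ... | there Mij′          = Mij′

  CrossIntersecting-pick : ∀ {L x L′ Is} → L ↭ x ∷ L′ → CrossIntersecting L Is →
    CrossIntersecting L′ (filterᵇ (λ i → not (A i x)) Is)
  CrossIntersecting-pick {x = x} {Is = Is} L↭x∷L′ C =
    AllPairs-map-All (λ ¬Aix ¬Ajx (Mij , Mji) → Meets-pick L↭x∷L′ (to T-not-≡ ¬Aix) Mij ,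
                                                Meets-pick L↭x∷L′ (to T-not-≡ ¬Ajx) Mji)
      (all-filter (T? ∘ λ i → not (A i x)) Is) (AllPairs.filter⁺ (T? ∘ λ i → not (A i x)) C)
    where open Equivalence using (to)

  sum-split : ∀ i (u v : ℕ) L →
    sum (map (λ x → if A i x then 0 else if B i x then u else v) L) ≡ #B i L * u + #R i L * v
  sum-split i u v []      = refl
  sum-split i u v (x ∷ L) with A i x in Aix | B i x in Bix
  ... | true  | true  = contradiction (trans (sym (disjoint i x Aix)) Bix) λ ()
  ... | true  | false = sum-split i u v L
  ... | false | true  = trans (cong (u +_) (sum-split i u v L)) (sym (+-assoc u (#B i L * u) (#R i L * v)))
  ... | false | false = trans (cong (v +_) (sum-split i u v L)) (x∙yz≈y∙xz v (#B i L * u) (#R i L * v))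
    where open import Algebra.Properties.CommutativeSemigroup +-commutativeSemigroup using (x∙yz≈y∙xz)

  pickTerm : I → G × List G → ℕ
  pickTerm i (x , L′) = if not (A i x) then lubellAt i L′ else 0

  -- Sort the orderings counted by lubellAt i L by their last element x: x is not in A i, and
  -- removing it leaves an ordering counted by lubellAt i L′ for the rest L′ of L.
  lubellAt-picks : ∀ i L → 1 ≤ #B i L → lubellAt i L ≡ sum (map (pickTerm i) (picks L))
  lubellAt-picks i L 1≤b = begin
    lubell a b r                                          ≡⟨ cong (λ b → lubell a b r) b≡1+b′ ⟩
    lubell a (suc b′) r                                   ≡⟨ lubell-suc a b′ r ⟩
    suc b′ * lubell a b′ r + r * lubell a (suc b′) (pred r) ≡⟨ cong (λ b → b * u + r * lubell a b (pred r)) b≡1+b′ ⟨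
    b * u + r * v                                         ≡⟨ sum-split i u v L ⟨
    sum (map classify L)                                  ≡⟨ cong (sum ∘ map classify) (map-proj₁-picks L) ⟨
    sum (map classify (map proj₁ (picks L)))              ≡⟨ cong sum (map-∘ (picks L)) ⟨
    sum (map (classify ∘ proj₁) (picks L))                ≡⟨ cong sum (map-cong-local (All.map pickTerm≡classify (picks-↭ L))) ⟨
    sum (map (pickTerm i) (picks L))                      ∎
    where
    open ≡-Reasoning
    a = #A i L
    b = #B i L
    r = #R i L
    b′ = pred b
    b≡1+b′ : b ≡ suc b′
    b≡1+b′ = sym (suc-pred b {{>-nonZero 1≤b}})
    u = lubell a b′ r
    v = lubell a b (pred r)
    classify : G → ℕ
    classify x = if A i x then 0 else if B i x then u else v
    pickTerm≡classify : ∀ {(x , L′) : G × List G} → L ↭ x ∷ L′ → pickTerm i (x , L′) ≡ classify x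
    pickTerm≡classify {x , L′} L↭x∷L′ with A i x in Aix | B i x in Bix
    ... | true  | _     = refl
    ... | false | true
      rewrite count-pick (A i) L↭x∷L′ Aix | count-pick (B i) L↭x∷L′ Bix
            | count-pick (λ g → not (A i g ∨ B i g)) L↭x∷L′ (cong₂ (λ α β → not (α ∨ β)) Aix Bix) = refl
    ... | false | false
      rewrite count-pick (A i) L↭x∷L′ Aix | count-pick (B i) L↭x∷L′ Bix
            | count-pick (λ g → not (A i g ∨ B i g)) L↭x∷L′ (cong₂ (λ α β → not (α ∨ β)) Aix Bix) = refl

  length-picks : ∀ (L : List G) → length (picks L) ≡ length L
  length-picks L = trans (sym (length-map proj₁ (picks L))) (cong length (map-proj₁-picks L))

  bollobás : ∀ n L → length L ≡ n → ∀ Is → CrossIntersecting L Is → sum (map (λ i → lubellAt i L) Is) ≤ n !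
  bollobás n       L _     []           _ = z≤n
  bollobás n       L |L|≡n (i ∷ [])     _ =
    subst₂ (λ s m → s ≤ m !) (sym (+-identityʳ _)) |L|≡n (lubellAt≤! i L)
  bollobás zero    [] _  (_ ∷ _ ∷ _) (((() , _) ∷ _) ∷ _)
  bollobás (suc n) L  |L|≡1+n Is@(_ ∷ _ ∷ _) C = begin
    sum (map (λ i → lubellAt i L) Is)
      ≡⟨ cong sum (map-cong-local (All.map (lubellAt-picks _ L) (CrossIntersecting⇒#B-pos (s≤s (s≤s z≤n)) C))) ⟩
    sum (map (λ i → sum (map (pickTerm i) (picks L))) Is)
      ≡⟨ sum-map-comm pickTerm Is (picks L) ⟩
    sum (map (λ xL → sum (map (λ i → pickTerm i xL) Is)) (picks L))
      ≡⟨ cong sum (map-cong (λ (x , L′) → sum-map-filterᵇ (λ i → not (A i x)) (λ i → lubellAt i L′) Is) (picks L)) ⟨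
    sum (map restricted (picks L))
      ≤⟨ sum-map-mono (All.map restricted≤n! (picks-↭ L)) ⟩
    sum (map (λ _ → n !) (picks L))
      ≡⟨ sum-map-const (n !) (picks L) ⟩
    length (picks L) * n !
      ≡⟨ cong (_* n !) (trans (length-picks L) |L|≡1+n) ⟩
    suc n !  ∎
    where
    open ≤-Reasoning
    restricted : G × List G → ℕ
    restricted (x , L′) = sum (map (λ i → lubellAt i L′) (filterᵇ (λ i → not (A i x)) Is))
    restricted≤n! : ∀ {(x , L′) : G × List G} → L ↭ x ∷ L′ → restricted (x , L′) ≤ n !
    restricted≤n! L↭x∷L′ =
      bollobás n _ (suc-injective (trans (sym (↭-length L↭x∷L′)) |L|≡1+n)) _ (CrossIntersecting-pick L↭x∷L′ C)

module _ {t : ℕ} where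

  _≟ᵛ_ : DecidableEquality (Vertex t)
  _≟ᵛ_ = ≡-dec Fin._≟_ Bool._≟_

  open DecMembership _≟ᵛ_ using (_∈?_) public

  allVertices : List (Vertex t)
  allVertices = cartesianProduct (allFin t) (false ∷ true ∷ [])

  ∈-allVertices : ∀ v → v ∈ allVertices
  ∈-allVertices (i , false) = ∈-cartesianProduct⁺ (∈-allFin i) (here refl)
  ∈-allVertices (i , true)  = ∈-cartesianProduct⁺ (∈-allFin i) (there (here refl))

  allVertices-Unique : Unique allVertices
  allVertices-Unique = cartesianProduct⁺ (allFin⁺ t) (((λ ()) ∷ []) ∷ [] ∷ [])

  inClique : Vertex t → Clique t → Bool
  inClique v C = does (v ∈? verts C)

  inClique⇒∈ : ∀ v C → inClique v C ≡ true → v ∈ verts C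
  inClique⇒∈ v C v∈ᵇC with v ∈? verts C
  ... | yes v∈C = v∈C

  ∈⇒inClique : ∀ {v} C → v ∈ verts C → inClique v C ≡ true
  ∈⇒inClique {v} C = dec-true (v ∈? verts C)

  canonical : Clique t → List (Vertex t)
  canonical C = filter (_∈? verts C) allVertices

  length-canonical≤size : ∀ C → length (canonical C) ≤ size C
  length-canonical≤size C =
    Unique∧⊆⇒length≤ (filter⁺ (_∈? verts C) allVertices-Unique) (proj₂ ∘ ∈-filter⁻ (_∈? verts C) {xs = allVertices})

  count-cartesianProduct : ∀ (p : Vertex t → Bool) is →
    count p (cartesianProduct is (false ∷ true ∷ [])) ≡ sum (map (λ i → iverson (p (i , false)) + iverson (p (i , true))) is)
  count-cartesianProduct p []       = refl
  count-cartesianProduct p (i ∷ is) =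
    trans (sym (+-assoc (iverson (p (i , false))) _ _)) (cong (_ +_) (count-cartesianProduct p is))

  incidencesOf : Clique t → Fin t → ℕ
  incidencesOf C i = iverson (inClique (i , false) C) + iverson (inClique (i , true) C)

  incidencesOf≤size : ∀ C → sum (map (incidencesOf C) (allFin t)) ≤ size C
  incidencesOf≤size C = begin
    sum (map (incidencesOf C) (allFin t))
      ≡⟨ count-cartesianProduct (λ v → inClique v C) (allFin t) ⟨
    count (λ v → inClique v C) allVertices ≡⟨ count≡length-filter (_∈? verts C) allVertices ⟩
    length (canonical C)                   ≤⟨ length-canonical≤size C ⟩
    size C                                 ∎
    where open ≤-Reasoning

-- Lower bound

module LowerBound (t : ℕ) where

  A B : Fin t → Clique t → Bool
  A i = inClique (i , false)
  B i = inClique (i , true)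

  A∩B≡∅ : ∀ i C → A i C ≡ true → B i C ≡ false
  A∩B≡∅ i C xᵢ∈C with (i , true) ∈? verts C
  ... | no  _    = refl
  ... | yes yᵢ∈C = contradiction refl (pairwise C (inClique⇒∈ (i , false) C xᵢ∈C) yᵢ∈C λ ())

  open Bollobás A B A∩B≡∅

  covering⇒CrossIntersecting : ∀ {𝒞} → IsCovering 𝒞 → CrossIntersecting 𝒞 (allFin t)
  covering⇒CrossIntersecting {𝒞} cover = AllPairs.tabulate⁺ (λ i≢j → meets i≢j , meets (i≢j ∘ sym))
    where
    meets : ∀ {i j} → i ≢ j → Meets i j 𝒞
    meets i≢j = Any.map (λ {C} (xᵢ∈C , yⱼ∈C) → ∈⇒inClique C xᵢ∈C , ∈⇒inClique C yⱼ∈C) (cover _ _ i≢j)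

  incidences : List (Clique t) → ℕ
  incidences 𝒞 = sum (map (λ i → #A i 𝒞 + #B i 𝒞) (allFin t))

  incidences≤weight : ∀ 𝒞 → incidences 𝒞 ≤ weight 𝒞
  incidences≤weight 𝒞 = begin
    sum (map (λ i → #A i 𝒞 + #B i 𝒞) (allFin t))
      ≡⟨ cong sum (map-cong (λ i → sum-map-+ (iverson ∘ A i) (iverson ∘ B i) 𝒞) (allFin t)) ⟨
    sum (map (λ i → sum (map (λ C → iverson (A i C) + iverson (B i C)) 𝒞)) (allFin t))
      ≡⟨ sum-map-comm (λ i C → iverson (A i C) + iverson (B i C)) (allFin t) 𝒞 ⟩
    sum (map (λ C → sum (map (λ i → iverson (A i C) + iverson (B i C)) (allFin t))) 𝒞)
      ≤⟨ sum-map-mono {xs = 𝒞} (All.tabulate λ {C} _ → incidencesOf≤size C) ⟩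
    weight 𝒞 ∎
    where open ≤-Reasoning

  lubell-tangentAt : ∀ M 𝒞 i → 1 ≤ #B i 𝒞 →
    length 𝒞 ! * (2 + M) ≤ 2 * central M * lubellAt i 𝒞 + length 𝒞 ! * (#A i 𝒞 + #B i 𝒞)
  lubell-tangentAt M 𝒞 i 1≤#B = subst (λ n → n ! * (2 + M) ≤ 2 * central M * lubellAt i 𝒞 + n ! * (#A i 𝒞 + #B i 𝒞))
    (#A+#B+#R≡length i 𝒞) (lubell-tangent (#A i 𝒞) (#B i 𝒞) (#R i 𝒞) M (≤-trans 1≤#B (m≤n+m _ _)))

  bollobás-bound : ∀ M 𝒞 → 2 ≤ t → IsCovering 𝒞 → t * (2 + M) ≤ 2 * central M + incidences 𝒞
  bollobás-bound M 𝒞 2≤t cover = *-cancelˡ-≤ (K !) {{K !≢0}} (begin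
    K ! * (t * (2 + M))
      ≡⟨ x∙yz≈y∙xz (K !) t (2 + M) ⟩
    t * (K ! * (2 + M))
      ≡⟨ trans (cong (_* (K ! * (2 + M))) (sym |allFin|≡t)) (sym (sum-map-const _ (allFin t))) ⟩
    sum (map (λ _ → K ! * (2 + M)) (allFin t))
      ≤⟨ sum-map-mono (All.map (λ {i} → lubell-tangentAt M 𝒞 i) (CrossIntersecting⇒#B-pos 2≤|allFin| C)) ⟩
    sum (map (λ i → 2 * central M * lubellAt i 𝒞 + K ! * N i) (allFin t))
      ≡⟨ sum-map-+ (λ i → 2 * central M * lubellAt i 𝒞) (λ i → K ! * N i) (allFin t) ⟩
    sum (map (λ i → 2 * central M * lubellAt i 𝒞) (allFin t)) + sum (map (λ i → K ! * N i) (allFin t))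
      ≡⟨ cong₂ _+_ (sum-map-* (2 * central M) (λ i → lubellAt i 𝒞) (allFin t)) (sum-map-* (K !) N (allFin t)) ⟩
    2 * central M * sum (map (λ i → lubellAt i 𝒞) (allFin t)) + K ! * incidences 𝒞
      ≤⟨ +-monoˡ-≤ (K ! * incidences 𝒞) (*-monoʳ-≤ (2 * central M) (bollobás K 𝒞 refl (allFin t) C)) ⟩
    2 * central M * K ! + K ! * incidences 𝒞
      ≡⟨ factor (2 * central M) (K !) (incidences 𝒞) ⟩
    K ! * (2 * central M + incidences 𝒞) ∎)
    where
    open ≤-Reasoning
    open import Algebra.Properties.CommutativeSemigroup *-commutativeSemigroup using (x∙yz≈y∙xz)
    K = length 𝒞
    N : Fin t → ℕ
    N i = #A i 𝒞 + #B i 𝒞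
    C : CrossIntersecting 𝒞 (allFin t)
    C = covering⇒CrossIntersecting cover
    |allFin|≡t : length (allFin t) ≡ t
    |allFin|≡t = length-tabulate id
    2≤|allFin| : 2 ≤ length (allFin t)
    2≤|allFin| = subst (2 ≤_) (sym |allFin|≡t) 2≤t
    factor : ∀ c k n → c * k + k * n ≡ k * (c + n)
    factor = solve-∀

  lowerBound : ∀ M → central M < t → ∀ 𝒞 → IsCovering 𝒞 → t * M ≤ weight 𝒞
  lowerBound M cM<t 𝒞 cover = ≤-trans t*M≤incidences (incidences≤weight 𝒞)
    where
    open ≤-Reasoning
    t*M≤incidences : t * M ≤ incidences 𝒞
    t*M≤incidences = +-cancelˡ-≤ (2 * t) _ _ (begin
      2 * t + t * M               ≡⟨ cong (_+ t * M) (*-comm 2 t) ⟩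
      t * 2 + t * M               ≡⟨ *-distribˡ-+ t 2 M ⟨
      t * (2 + M)                 ≤⟨ bollobás-bound M 𝒞 (≤-trans (s≤s (central-pos M)) cM<t) cover ⟩
      2 * central M + incidences 𝒞 ≤⟨ +-monoˡ-≤ (incidences 𝒞) (*-monoʳ-≤ 2 (<⇒≤ cM<t)) ⟩
      2 * t + incidences 𝒞        ∎)

lowerBound-δ : ∀ t d → IsDelta t d → ∀ (𝒞 : List (Clique t)) → IsCovering 𝒞 → t * d ≤ weight 𝒞
lowerBound-δ t d (suc zero , _ , refl) 𝒞 _ = subst (_≤ weight 𝒞) (sym (*-zeroʳ t)) z≤n
lowerBound-δ t d (suc (suc M) , (_ , m-least) , refl) 𝒞 cover with t ≤? suc M choose ⌈ suc M /2⌉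
... | yes t≤C = contradiction (m-least (suc M) (s≤s z≤n , t≤C)) (<-irrefl refl)
... | no  t≰C = LowerBound.lowerBound t (suc M) central<t 𝒞 cover
  where
  central<t : central (suc M) < t
  central<t = subst (_< t) (sym (binomial≡choose (suc M) ⌈ suc M /2⌉)) (≰⇒> t≰C)

-- Upper bound

subsetsOfSize : ∀ n h → Vec (Subset n) (binomial n h)
subsetsOfSize zero    zero    = [] ∷ []
subsetsOfSize zero    (suc h) = []
subsetsOfSize (suc n) zero    = Vec.map (outside ∷_) (subsetsOfSize n zero)
subsetsOfSize (suc n) (suc h) =
  Vec.map (inside ∷_) (subsetsOfSize n h) Vec.++ Vec.map (outside ∷_) (subsetsOfSize n (suc h))

subsetsOfSize-size : ∀ n h → VecAll.All (λ p → ∣ p ∣ ≡ h) (subsetsOfSize n h)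
subsetsOfSize-size zero    zero    = refl ∷ []
subsetsOfSize-size zero    (suc h) = []
subsetsOfSize-size (suc n) zero    = VecAll.map⁺ (subsetsOfSize-size n zero)
subsetsOfSize-size (suc n) (suc h) =
  VecAll.++⁺ (VecAll.map⁺ (VecAll.map (cong suc) (subsetsOfSize-size n h))) (VecAll.map⁺ (subsetsOfSize-size n (suc h)))

map-∷-Unique : ∀ {n m} b {ps : Vec (Subset n) m} → VecUnique.Unique ps → VecUnique.Unique (Vec.map (b ∷_) ps)
map-∷-Unique b = VecAllPairs.map⁺ ∘ VecAllPairs.map (λ p≢q → p≢q ∘ Vec.∷-injectiveʳ)

subsetsOfSize-Unique : ∀ n h → VecUnique.Unique (subsetsOfSize n h)
subsetsOfSize-Unique zero    zero    = [] ∷ []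
subsetsOfSize-Unique zero    (suc h) = []
subsetsOfSize-Unique (suc n) zero    = map-∷-Unique outside (subsetsOfSize-Unique n zero)
subsetsOfSize-Unique (suc n) (suc h) =
  VecAllPairs.++⁺ (map-∷-Unique inside (subsetsOfSize-Unique n h)) (map-∷-Unique outside (subsetsOfSize-Unique n (suc h)))
    (VecAll.map⁺ (VecAll.universal (λ _ → VecAll.map⁺ (VecAll.universal (λ _ ()) _)) _))

PointWith : ∀ {n} → Bool → Bool → Subset n → Subset n → Set
PointWith α β p q = ∃ λ l → Vec.lookup p l ≡ α × Vec.lookup q l ≡ β

point-∷ : ∀ {n α β a b} {p q : Subset n} → PointWith α β p q → PointWith α β (a ∷ p) (b ∷ q)
point-∷ (l , pl , ql) = suc l , pl , ql

∣q∣<∣p∣⇒point∈p∉q : ∀ {n} (p q : Subset n) → ∣ q ∣ < ∣ p ∣ → PointWith inside outside p q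
∣q∣<∣p∣⇒point∈p∉q (inside  ∷ p) (outside ∷ q) _           = zero , refl , refl
∣q∣<∣p∣⇒point∈p∉q (inside  ∷ p) (inside  ∷ q) (s≤s q<p) = point-∷ (∣q∣<∣p∣⇒point∈p∉q p q q<p)
∣q∣<∣p∣⇒point∈p∉q (outside ∷ p) (outside ∷ q) q<p       = point-∷ (∣q∣<∣p∣⇒point∈p∉q p q q<p)
∣q∣<∣p∣⇒point∈p∉q (outside ∷ p) (inside  ∷ q) 1+q<p     =
  point-∷ (∣q∣<∣p∣⇒point∈p∉q p q (<-trans (n<1+n ∣ q ∣) 1+q<p))

≢∧∣p∣≡∣q∣⇒point∈p∉q : ∀ {n} (p q : Subset n) → p ≢ q → ∣ p ∣ ≡ ∣ q ∣ → PointWith inside outside p q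
≢∧∣p∣≡∣q∣⇒point∈p∉q []            []            p≢q _   = contradiction refl p≢q
≢∧∣p∣≡∣q∣⇒point∈p∉q (inside  ∷ p) (outside ∷ q) _   _   = zero , refl , refl
≢∧∣p∣≡∣q∣⇒point∈p∉q (outside ∷ p) (inside  ∷ q) _   p≡1+q =
  point-∷ (∣q∣<∣p∣⇒point∈p∉q p q (≤-reflexive (sym p≡1+q)))
≢∧∣p∣≡∣q∣⇒point∈p∉q (inside  ∷ p) (inside  ∷ q) p≢q p≡q =
  point-∷ (≢∧∣p∣≡∣q∣⇒point∈p∉q p q (p≢q ∘ cong (inside ∷_)) (suc-injective p≡q))
≢∧∣p∣≡∣q∣⇒point∈p∉q (outside ∷ p) (outside ∷ q) p≢q p≡q =
  point-∷ (≢∧∣p∣≡∣q∣⇒point∈p∉q p q (p≢q ∘ cong (outside ∷_)) p≡q)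

n<∣p∣+∣q∣⇒point∈p∩q : ∀ {n} (p q : Subset n) → n < ∣ p ∣ + ∣ q ∣ → PointWith inside inside p q
n<∣p∣+∣q∣⇒point∈p∩q []            []            ()
n<∣p∣+∣q∣⇒point∈p∩q (inside  ∷ p) (inside  ∷ q) _               = zero , refl , refl
n<∣p∣+∣q∣⇒point∈p∩q (inside  ∷ p) (outside ∷ q) (s≤s n<p+q)    = point-∷ (n<∣p∣+∣q∣⇒point∈p∩q p q n<p+q)
n<∣p∣+∣q∣⇒point∈p∩q {suc n} (outside ∷ p) (inside ∷ q) 1+n<p+1+q =
  point-∷ (n<∣p∣+∣q∣⇒point∈p∩q p q (≤-pred (subst (suc n <_) (+-suc ∣ p ∣ ∣ q ∣) 1+n<p+1+q)))
n<∣p∣+∣q∣⇒point∈p∩q (outside ∷ p) (outside ∷ q) 1+n<p+q       =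
  point-∷ (n<∣p∣+∣q∣⇒point∈p∩q p q (<-trans (n<1+n _) 1+n<p+q))

module CliqueCover {t n h : ℕ} (A : Fin t → Subset n) (A-injective : ∀ {i j} → A i ≡ A j → i ≡ j)
                   (∣A∣≡h : ∀ i → ∣ A i ∣ ≡ h) (n<2h : n < h + h) where

  -- Clique zero is {y_i}; clique suc l contains x_i if l ∈ A_i and y_i otherwise.
  side : Fin t → Fin (suc n) → Bool
  side i zero    = true
  side i (suc l) = not (Vec.lookup (A i) l)

  point⇒sides : ∀ {i j α β} → PointWith α β (A i) (A j) → ∃ λ l → side i l ≡ not α × side j l ≡ not β
  point⇒sides (l , e₁ , e₂) = suc l , cong not e₁ , cong not e₂

  vertexAt : Fin (suc n) → Fin t → Vertex t
  vertexAt l i = i , side i l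

  cliqueAt : Fin (suc n) → Clique t
  cliqueAt l = clique (map (vertexAt l) (allFin t)) vertices-Unique vertices-pairwise
    where
    vertices-Unique : Unique (map (vertexAt l) (allFin t))
    vertices-Unique = Unique.map⁺ (cong proj₁) (allFin⁺ t)
    vertices-pairwise : ∀ {u v} → u ∈ map (vertexAt l) (allFin t) → v ∈ map (vertexAt l) (allFin t) → ¬ u ≡ v → Adj u v
    vertices-pairwise u∈ v∈ u≢v with ∈-map⁻ (vertexAt l) u∈ | ∈-map⁻ (vertexAt l) v∈
    ... | i , _ , refl | j , _ , refl = u≢v ∘ cong (vertexAt l)

  cover : List (Clique t)
  cover = map cliqueAt (allFin (suc n))

  cover-weight : weight cover ≡ suc n * t
  cover-weight = begin
    sum (map size (map cliqueAt (allFin (suc n))))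
      ≡⟨ cong sum (map-∘ (allFin (suc n))) ⟨
    sum (map (size ∘ cliqueAt) (allFin (suc n)))
      ≡⟨ cong sum (map-cong (λ l → trans (length-map (vertexAt l) (allFin t)) (length-tabulate id)) (allFin (suc n))) ⟩
    sum (map (λ _ → t) (allFin (suc n)))
      ≡⟨ sum-map-const t (allFin (suc n)) ⟩
    length (allFin (suc n)) * t
      ≡⟨ cong (_* t) (length-tabulate {n = suc n} id) ⟩
    suc n * t ∎
    where open ≡-Reasoning

  side-choice : ∀ {i j} → i ≢ j → ∀ α β → ∃ λ l → side i l ≡ α × side j l ≡ β
  side-choice         i≢j true  true  = zero , refl , refl
  side-choice {i} {j} i≢j false false = point⇒sides (n<∣p∣+∣q∣⇒point∈p∩q (A i) (A j) n<∣Ai∣+∣Aj∣)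
    where
    n<∣Ai∣+∣Aj∣ : n < ∣ A i ∣ + ∣ A j ∣
    n<∣Ai∣+∣Aj∣ = subst₂ (λ a b → n < a + b) (sym (∣A∣≡h i)) (sym (∣A∣≡h j)) n<2h
  side-choice {i} {j} i≢j false true  =
    point⇒sides (≢∧∣p∣≡∣q∣⇒point∈p∉q (A i) (A j) (i≢j ∘ A-injective) (trans (∣A∣≡h i) (sym (∣A∣≡h j))))
  side-choice {i} {j} i≢j true  false =
    let l , j-side , i-side = side-choice (i≢j ∘ sym) false true in l , i-side , j-side

  cover-covers : IsCovering cover
  cover-covers (i , α) (j , β) i≢j with l , refl , refl ← side-choice i≢j α β =
    Any.map⁺ (Any.map (λ { refl → ∈-map⁺ _ (∈-allFin i) , ∈-map⁺ _ (∈-allFin j) }) (∈-allFin l))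

upperBound : ∀ t s → IsSigma t s → ∃ λ (𝒞 : List (Clique t)) → IsCovering 𝒞 × weight 𝒞 ≡ t * s
upperBound t zero    ((() , _) , _)
upperBound t (suc n) ((_ , t≤C) , _) = cover , cover-covers , trans cover-weight (*-comm (suc n) t)
  where
  h = ⌈ suc n /2⌉
  t≤binomial : t ≤ binomial n h
  t≤binomial = subst (t ≤_) (sym (binomial≡choose n h)) t≤C
  A : Fin t → Subset n
  A i = Vec.lookup (subsetsOfSize n h) (inject≤ i t≤binomial)
  A-injective : ∀ {i j} → A i ≡ A j → i ≡ j
  A-injective = inject≤-injective _ _ _ _ ∘ VecUnique.lookup-injective (subsetsOfSize-Unique n h) _ _
  n<2h : n < h + h
  n<2h = subst (suc n ≤_) (cong (h +_) (+-identityʳ h)) (n≤2*⌈n/2⌉ (suc n))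
  open CliqueCover {t} {n} {h} A A-injective (VecAll.lookup⁺ (subsetsOfSize-size n h) ∘ λ i → inject≤ i t≤binomial) n<2h

-- Existence of the minimum

module _ {t : ℕ} where

  Adj? : (u v : Vertex t) → Dec (Adj u v)
  Adj? u v = ¬? (proj₁ u Fin.≟ proj₁ v)

  toClique : (V : List (Vertex t)) → AllPairs Adj V → Clique t
  toClique V adj = clique V (AllPairs.map (λ u≁v → u≁v ∘ cong proj₁) adj) (AllPairs⇒pairwise (λ u≁v → u≁v ∘ sym) adj)

  toCliques : (𝒱 : List (List (Vertex t))) → All (AllPairs Adj) 𝒱 → List (Clique t)
  toCliques []      []         = []
  toCliques (V ∷ 𝒱) (adj ∷ adjs) = toClique V adj ∷ toCliques 𝒱 adjs

  weight-toCliques : ∀ 𝒱 adjs → weight (toCliques 𝒱 adjs) ≡ sum (map length 𝒱)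
  weight-toCliques []      []           = refl
  weight-toCliques (V ∷ 𝒱) (adj ∷ adjs) = cong (length V +_) (weight-toCliques 𝒱 adjs)

  Covers : List (List (Vertex t)) → Set
  Covers 𝒱 = All (λ u → All (λ v → Adj u v → Any (λ V → u ∈ V × v ∈ V) 𝒱) allVertices) allVertices

  Covers? : ∀ 𝒱 → Dec (Covers 𝒱)
  Covers? 𝒱 = all? (λ u → all? (λ v → Adj? u v →-dec any? (λ V → (u ∈? V) ×-dec (v ∈? V)) 𝒱) allVertices) allVertices

  toCliques-covering : ∀ 𝒱 adjs → Covers 𝒱 → IsCovering (toCliques 𝒱 adjs)
  toCliques-covering 𝒱 adjs covers u v u~v =
    lift 𝒱 adjs (All.lookup (All.lookup covers (∈-allVertices u)) (∈-allVertices v) u~v)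
    where
    lift : ∀ 𝒱 adjs → Any (λ V → u ∈ V × v ∈ V) 𝒱 → Any (λ C → u ∈ verts C × v ∈ verts C) (toCliques 𝒱 adjs)
    lift (V ∷ 𝒱) (adj ∷ adjs) (here uv∈V)  = here uv∈V
    lift (V ∷ 𝒱) (adj ∷ adjs) (there uv∈𝒱) = there (lift 𝒱 adjs uv∈𝒱)

  GoodFamily : ℕ → List (List (Vertex t)) → Set
  GoodFamily w 𝒱 = All (AllPairs Adj) 𝒱 × Covers 𝒱 × sum (map length 𝒱) ≤ w

  good-family⇒covering : ∀ {w 𝒱} → GoodFamily w 𝒱 → ∃ λ 𝒞 → IsCovering 𝒞 × weight 𝒞 ≤ w
  good-family⇒covering {𝒱 = 𝒱} (adjs , covers , ∑≤w) =
    toCliques 𝒱 adjs , toCliques-covering 𝒱 adjs covers , subst (_≤ _) (sym (weight-toCliques 𝒱 adjs)) ∑≤w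

  GoodFamily? : ∀ w 𝒱 → Dec (GoodFamily w 𝒱)
  GoodFamily? w 𝒱 = all? (allPairs? Adj?) 𝒱 ×-dec Covers? 𝒱 ×-dec sum (map length 𝒱) ≤? w

  canonical-Adj : ∀ (C : Clique t) → AllPairs Adj (canonical C)
  canonical-Adj C = AllPairs-map-All (pairwise C) (all-filter (_∈? verts C) allVertices)
    (AllPairs.filter⁺ (_∈? verts C) allVertices-Unique)

  covering⇒good-family : ∀ w → (∃ λ 𝒞 → IsCovering 𝒞 × weight 𝒞 ≤ w) →
    Any (GoodFamily w) (boundedLists (sublists allVertices) w)
  covering⇒good-family w (𝒞 , cover , weight≤w) =
    Any.map (λ { refl → adjs , covers , ∑≤w }) (∈-boundedLists w 𝒱⊆sublists (≤-trans |𝒱|≤∑ ∑≤w))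
    where
    nonempty? : (V : List (Vertex t)) → Dec (1 ≤ length V)
    nonempty? V = 1 ≤? length V
    𝒱 = filter nonempty? (map canonical 𝒞)
    𝒱⊆sublists : All (_∈ sublists allVertices) 𝒱
    𝒱⊆sublists = All.filter⁺ nonempty?
      (All.map⁺ {f = canonical} (All.universal (λ C → filter∈sublists (_∈? verts C) allVertices) 𝒞))
    adjs : All (AllPairs Adj) 𝒱
    adjs = All.filter⁺ nonempty? (All.map⁺ {f = canonical} (All.universal canonical-Adj 𝒞))
    covers : Covers 𝒱
    covers = All.universal (λ u → All.universal (λ v u~v →
      Any-filter⁺ nonempty? (λ { (here _ , _) → s≤s z≤n ; (there _ , _) → s≤s z≤n })
        (Any.map⁺ (Any.map (λ {C} (u∈C , v∈C) → ∈-filter⁺ (_∈? verts C) (∈-allVertices u) u∈C ,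
                                                 ∈-filter⁺ (_∈? verts C) (∈-allVertices v) v∈C)
                           (cover u v u~v)))) allVertices) allVertices
    ∑≤w : sum (map length 𝒱) ≤ w
    ∑≤w = begin
      sum (map length 𝒱)                   ≤⟨ sum-map-filter≤ nonempty? length (map canonical 𝒞) ⟩
      sum (map length (map canonical 𝒞))   ≡⟨ cong sum (map-∘ 𝒞) ⟨
      sum (map (length ∘ canonical) 𝒞)     ≤⟨ sum-map-mono (All.universal length-canonical≤size 𝒞) ⟩
      weight 𝒞                             ≤⟨ weight≤w ⟩
      w                                    ∎
      where open ≤-Reasoning
    |𝒱|≤∑ : length 𝒱 ≤ sum (map length 𝒱)
    |𝒱|≤∑ = begin
      length 𝒱                 ≡⟨ *-identityʳ (length 𝒱) ⟨
      length 𝒱 * 1             ≡⟨ sum-map-const 1 𝒱 ⟨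
      sum (map (λ _ → 1) 𝒱)    ≤⟨ sum-map-mono (all-filter nonempty? (map canonical 𝒞)) ⟩
      sum (map length 𝒱)       ∎
      where open ≤-Reasoning

  covering-of-weight≤? : ∀ w → Dec (∃ λ 𝒞 → IsCovering 𝒞 × weight 𝒞 ≤ w)
  covering-of-weight≤? w =
    Dec.map (mk⇔ (good-family⇒covering ∘ proj₂ ∘ Any.satisfied) (covering⇒good-family w))
            (any? (GoodFamily? w) (boundedLists (sublists allVertices) w))

  scc-exists : ∀ {𝒞₀ : List (Clique t)} → IsCovering 𝒞₀ → ∃ (IsSCC t)
  scc-exists = minimum-exists weight covering-of-weight≤?

theorem5 : ∀ (t : ℕ) → 0 < t → ∀ (s d : ℕ) → IsSigma t s → IsDelta t d →
    Σ ℕ λ n → IsSCC t n × (t * d ≤ n × n ≤ t * s)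
theorem5 t _ s d σ δ with upperBound t s σ
... | 𝒞₀ , cover₀ , weight₀≡t*s with scc-exists cover₀
... | n , scc@((𝒞 , cover , weight≡n) , n-least) =
  n , scc , subst (t * d ≤_) weight≡n (lowerBound-δ t d δ 𝒞 cover) , subst (n ≤_) weight₀≡t*s (n-least 𝒞₀ cover₀)
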